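{- For every integer $n \geq 3$, $$M'_D(K_{2,n}) \leq \min\{k \in \mathbb{N} : k(k-1)-1 \geq n\}.$$
   Context: $K_{2,n}$ is the complete bipartite graph with parts of sizes $2$ and $n$. A majority edge coloring is an edge coloring such that for every vertex $u$ and every color $\alpha$, at most half of the edges incident with $u$ have color $\alpha$. It is distinguishing if the only automorphism $\varphi$ of the graph with $c(\varphi(u)\varphi(v))=c(uv)$ for all edges $uv$ is the identity. $M'_D(G)$ is the least number of colors in an edge coloring of $G$ that is both majority and distinguishing. -}

module Defs where

open import Data.Nat using (ℕ; _*_; _≤_; _∸_)
open import Data.Fin using (Fin; _≟_)
open import Data.Fin.Properties using () renaming (_≟_ to _≟ᶠ_)
open import Data.Sum using (_⊎_; inj₁; inj₂)
open import Data.Maybe using (Maybe; just; nothing)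
import Data.Maybe.Properties as MP
open import Data.List using (List; map; _++_; filter; length; allFin)
open import Data.Bool using (Bool; true; false)
open import Relation.Binary.PropositionalEquality using (_≡_)
open import Relation.Nullary using (Dec; yes; no; ¬_)
open import Function.Definitions using (Bijective)
open import Data.Product using (_×_)

V : ℕ → Set
V n = Fin 2 ⊎ Fin n

allV : (n : ℕ) → List (V n)
allV n = map inj₁ (allFin 2) ++ map inj₂ (allFin n)

Adj : {n : ℕ} → V n → V n → Set
Adj (inj₁ _) (inj₂ _) = Data.Unit.⊤ where import Data.Unit
Adj (inj₂ _) (inj₁ _) = Data.Unit.⊤ where import Data.Unit
Adj (inj₁ _) (inj₁ _) = Data.Empty.⊥ where import Data.Empty
Adj (inj₂ _) (inj₂ _) = Data.Empty.⊥ where import Data.Empty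

-- An edge coloring of K_{2,n} with colors in Fin k: the edge {inj₁ i, inj₂ j} gets colour c i j.
EdgeColoring : ℕ → ℕ → Set
EdgeColoring n k = Fin 2 → Fin n → Fin k

col : {n k : ℕ} → EdgeColoring n k → V n → V n → Maybe (Fin k)
col c (inj₁ i) (inj₂ j) = just (c i j)
col c (inj₂ j) (inj₁ i) = just (c i j)
col c (inj₁ _) (inj₁ _) = nothing
col c (inj₂ _) (inj₂ _) = nothing

isEdge : {n : ℕ} → V n → V n → Bool
isEdge (inj₁ _) (inj₂ _) = true
isEdge (inj₂ _) (inj₁ _) = true
isEdge (inj₁ _) (inj₁ _) = false
isEdge (inj₂ _) (inj₂ _) = false

deg : {n : ℕ} → V n → ℕ
deg {n} u = length (filter (λ v → Data.Bool.Properties.T? (isEdge u v)) (allV n))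
  where import Data.Bool.Properties

colDeg : {n k : ℕ} → EdgeColoring n k → V n → Fin k → ℕ
colDeg {n} c u α = length (filter (λ v → MP.≡-dec _≟ᶠ_ (col c u v) (just α)) (allV n))

IsMajority : {n k : ℕ} → EdgeColoring n k → Set
IsMajority {n} {k} c = (u : V n) (α : Fin k) → 2 * colDeg c u α ≤ deg u

IsAutomorphism : {n : ℕ} → (V n → V n) → Set
IsAutomorphism {n} φ =
  Bijective _≡_ _≡_ φ × ((u v : V n) → (Adj u v → Adj (φ u) (φ v)) × (Adj (φ u) (φ v) → Adj u v))

PreservesColoring : {n k : ℕ} → EdgeColoring n k → (V n → V n) → Set
PreservesColoring {n} c φ = (u v : V n) → Adj u v → col c (φ u) (φ v) ≡ col c u v

IsDistinguishing : {n k : ℕ} → EdgeColoring n k → Set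
IsDistinguishing {n} c =
  (φ : V n → V n) → IsAutomorphism φ → PreservesColoring c φ → (v : V n) → φ v ≡ v

{-# OPTIONS --safe #-}
-- Let d = m be the number of colours and write the index of a leaf as t = a + q d with a < d.
-- The edges from leaf t to the two hubs get the colours a and a + q + 1 modulo d.  Since
-- n ≤ d(d−1)−1 we have 1 ≤ q + 1 ≤ d − 1, so the two colours at a leaf differ and distinct
-- leaves carry distinct ordered pairs.  At a hub each colour occurs at most once in every block
-- of d consecutive leaves, hence at most ⌈n/d⌉ ≤ n/2 times.  Since n ≥ 3, an automorphism maps
-- hubs to hubs; if it fixes them it fixes every leaf because the pairs are distinct, and it
-- cannot swap them because the pair (d−2, d−1) of leaf d−2 occurs reversed only at leaf
-- d(d−1)−1, which does not exist.  Minimality of m is what guarantees that leaf d−2 exists.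
module Submission where

open import Defs
open import Data.Nat
open import Data.Nat.Properties
open import Data.Nat.DivMod
open import Data.Nat.Tactic.RingSolver using (solve-∀)
open import Data.Bool using (true; false; if_then_else_)
import Data.Bool.Properties as Bool
open import Data.Fin using (Fin; zero; suc; toℕ; fromℕ<)
open import Data.Fin.Properties using (pigeonhole; toℕ-fromℕ<; toℕ<n; toℕ-injective)
  renaming (_≟_ to _≟ᶠ_; <-irrefl to <ᶠ-irrefl)
open import Data.List using (List; []; _∷_; length; filter; map; tabulate; allFin)
open import Data.List.Properties using (length-tabulate; filter-reject)
import Data.Maybe.Properties as Maybe
open import Data.Maybe using (just)
open import Data.Sum using (_⊎_; inj₁; inj₂; [_,_])
open import Data.Sum.Properties using (inj₂-injective)
open import Data.Product using (Σ; ∃; _×_; _,_; proj₁; proj₂)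
open import Data.Unit using (tt)
open import Data.Empty using (⊥-elim)
open import Function using (id; _∘_)
open import Relation.Nullary using (¬_; yes; no; does)
open import Relation.Unary using (Decidable)
open import Relation.Binary.Definitions using (DecidableEquality)
open import Relation.Binary.PropositionalEquality hiding ([_])

module Modular (d : ℕ) .{{_ : NonZero d}} where

  open ≡-Reasoning

  +-cong-% : ∀ m m′ n n′ → m % d ≡ m′ % d → n % d ≡ n′ % d →
             (m + n) % d ≡ (m′ + n′) % d
  +-cong-% m m′ n n′ m≡m′ n≡n′ = begin
    (m + n) % d           ≡⟨ %-distribˡ-+ m n d ⟩
    (m % d + n % d) % d   ≡⟨ cong₂ (λ a b → (a + b) % d) m≡m′ n≡n′ ⟩
    (m′ % d + n′ % d) % d ≡⟨ %-distribˡ-+ m′ n′ d ⟨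
    (m′ + n′) % d         ∎

  +-cancelˡ-% : ∀ o m n → (o + m) % d ≡ (o + n) % d → m % d ≡ n % d
  +-cancelˡ-% o m n eq = begin
    m % d                         ≡⟨ undo m ⟨
    ((d ∸ o % d) + (o + m)) % d   ≡⟨ +-cong-% (d ∸ o % d) _ (o + m) (o + n) refl eq ⟩
    ((d ∸ o % d) + (o + n)) % d   ≡⟨ undo n ⟩
    n % d                         ∎
    where
    inverse : (d ∸ o % d) + o ≡ suc (o / d) * d
    inverse = begin
      (d ∸ o % d) + o                   ≡⟨ cong (d ∸ o % d +_) (m≡m%n+[m/n]*n o d) ⟩
      (d ∸ o % d) + (o % d + o / d * d) ≡⟨ +-assoc (d ∸ o % d) (o % d) _ ⟨
      (d ∸ o % d) + o % d + o / d * d   ≡⟨ cong (_+ o / d * d) (m∸n+n≡m (m%n≤n o d)) ⟩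
      suc (o / d) * d                   ∎
    undo : ∀ x → ((d ∸ o % d) + (o + x)) % d ≡ x % d
    undo x = begin
      ((d ∸ o % d) + (o + x)) % d   ≡⟨ cong (_% d) (+-assoc (d ∸ o % d) o x) ⟨
      ((d ∸ o % d) + o + x) % d     ≡⟨ cong (λ y → (y + x) % d) inverse ⟩
      (suc (o / d) * d + x) % d     ≡⟨ cong (_% d) (+-comm (suc (o / d) * d) x) ⟩
      (x + suc (o / d) * d) % d     ≡⟨ [m+kn]%n≡m%n x (suc (o / d)) d ⟩
      x % d                         ∎

  +-cancelʳ-% : ∀ o m n → (m + o) % d ≡ (n + o) % d → m % d ≡ n % d
  +-cancelʳ-% o m n eq = +-cancelˡ-% o m n (begin
    (o + m) % d  ≡⟨ cong (_% d) (+-comm o m) ⟩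
    (m + o) % d  ≡⟨ eq ⟩
    (n + o) % d  ≡⟨ cong (_% d) (+-comm n o) ⟩
    (o + n) % d  ∎)

  %-/-injective : ∀ m n → m % d ≡ n % d → m / d ≡ n / d → m ≡ n
  %-/-injective m n m%≡n% m/≡n/ = begin
    m                   ≡⟨ m≡m%n+[m/n]*n m d ⟩
    m % d + m / d * d   ≡⟨ cong₂ (λ r q → r + q * d) m%≡n% m/≡n/ ⟩
    n % d + n / d * d   ≡⟨ m≡m%n+[m/n]*n n d ⟨
    n                   ∎

  q*d≤m<q*d+d⇒m/d≡q : ∀ m q → q * d ≤ m → m < q * d + d → m / d ≡ q
  q*d≤m<q*d+d⇒m/d≡q m q lower upper = ≤-antisym below above
    where
    below : m / d ≤ q
    below = m∸n≡0⇒m≤n (begin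
      m / d ∸ q           ≡⟨ [m∸n*o]/o≡m/o∸n m q d ⟨
      (m ∸ q * d) / d     ≡⟨ m<n⇒m/n≡0 (m<n+o⇒m∸n<o m (q * d) upper) ⟩
      0                   ∎)
    above : q ≤ m / d
    above = subst (_≤ m / d) (m*n/n≡m q d) (/-monoˡ-≤ d lower)

InjectiveOnBlocks : {A : Set} (d : ℕ) .{{_ : NonZero d}} → (ℕ → A) → Set
InjectiveOnBlocks d g = ∀ t u → t / d ≡ u / d → g t ≡ g u → t ≡ u

2*[1+q]≤q*d+[1+r] : ∀ {d} q r → 3 ≤ d → 3 ≤ q * d + suc r → 2 * suc q ≤ q * d + suc r
2*[1+q]≤q*d+[1+r] zero    r 3≤d 3≤n = ≤-trans (s≤s (s≤s z≤n)) 3≤n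
2*[1+q]≤q*d+[1+r] {d} (suc q) r 3≤d 3≤n = begin
  2 * suc (suc q)       ≤⟨ m≤m+n (2 * suc (suc q)) q ⟩
  2 * suc (suc q) + q   ≡⟨ rearrange q ⟩
  suc q * 3 + 1         ≤⟨ +-mono-≤ (*-monoʳ-≤ (suc q) 3≤d) (s≤s z≤n) ⟩
  suc q * d + suc r     ∎
  where
  open ≤-Reasoning
  rearrange : ∀ q → 2 * suc (suc q) + q ≡ suc q * 3 + 1
  rearrange = solve-∀

module Hits {A : Set} (_≟_ : DecidableEquality A) (g : ℕ → A) (α : A) where

  hits : ℕ → ℕ → ℕ
  hits s zero    = 0
  hits s (suc l) = if does (g s ≟ α) then suc (hits (suc s) l) else hits (suc s) l

  hits-+ : ∀ s a b → hits s (a + b) ≡ hits s a + hits (s + a) b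
  hits-+ s zero    b rewrite +-identityʳ s = refl
  hits-+ s (suc a) b rewrite +-suc s a with does (g s ≟ α)
  ... | true  = cong suc (hits-+ (suc s) a b)
  ... | false = hits-+ (suc s) a b

  private
    window-shift : ∀ {s l t} → t < suc s + l → t < s + suc l
    window-shift {s} {l} {t} = subst (t <_) (sym (+-suc s l))

  hits-none : ∀ s l → (∀ t → s ≤ t → t < s + l → g t ≢ α) → hits s l ≡ 0
  hits-none s zero    miss = refl
  hits-none s (suc l) miss with g s ≟ α
  ... | yes hit = ⊥-elim (miss s ≤-refl (m<m+n s z<s) hit)
  ... | no  _   = hits-none (suc s) l λ t s<t t<end →
                    miss t (<⇒≤ s<t) (window-shift t<end)

  hits-≤1 : ∀ s l →
            (∀ t u → s ≤ t → t < s + l → s ≤ u → u < s + l → g t ≡ α → g u ≡ α → t ≡ u) →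
            hits s l ≤ 1
  hits-≤1 s zero    unique = z≤n
  hits-≤1 s (suc l) unique with g s ≟ α
  ... | yes hit = ≤-reflexive (cong suc (hits-none (suc s) l λ t s<t t<end hitₜ → <-irrefl
                    (unique s t ≤-refl (m<m+n s z<s) (<⇒≤ s<t) (window-shift t<end) hit hitₜ) s<t))
  ... | no  _   = hits-≤1 (suc s) l λ t u s<t t<end s<u u<end →
                    unique t u (<⇒≤ s<t) (window-shift t<end) (<⇒≤ s<u) (window-shift u<end)

  hits-tabulate : ∀ {n} l s (h : Fin l → Fin n) → (∀ j → toℕ (h j) ≡ s + toℕ j) →
                  length (filter (λ j → g (toℕ j) ≟ α) (tabulate h)) ≡ hits s l
  hits-tabulate zero    s h shift = refl
  hits-tabulate (suc l) s h shift
    rewrite shift zero | +-identityʳ s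
    with does (g s ≟ α)
       | hits-tabulate l (suc s) (h ∘ suc) (λ j → trans (shift (suc j)) (+-suc s (toℕ j)))
  ... | true  | rest = cong suc rest
  ... | false | rest = rest

  module _ {d : ℕ} .{{_ : NonZero d}} (injective : InjectiveOnBlocks d g) where

    open Modular d

    hits-block≤1 : ∀ q r → r ≤ d → hits (q * d) r ≤ 1
    hits-block≤1 q r r≤d = hits-≤1 (q * d) r λ t u qd≤t t<end qd≤u u<end gt≡α gu≡α →
      injective t u (trans (inBlock qd≤t t<end) (sym (inBlock qd≤u u<end)))
                    (trans gt≡α (sym gu≡α))
      where
      inBlock : ∀ {t} → q * d ≤ t → t < q * d + r → t / d ≡ q
      inBlock {t} lower upper =
        q*d≤m<q*d+d⇒m/d≡q t q lower (<-≤-trans upper (+-monoʳ-≤ (q * d) r≤d))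

    hits-whole-blocks≤ : ∀ q → hits 0 (q * d) ≤ q
    hits-whole-blocks≤ zero    = z≤n
    hits-whole-blocks≤ (suc q) = begin
      hits 0 (d + q * d)              ≡⟨ cong (hits 0) (+-comm d (q * d)) ⟩
      hits 0 (q * d + d)              ≡⟨ hits-+ 0 (q * d) d ⟩
      hits 0 (q * d) + hits (q * d) d ≤⟨ +-mono-≤ (hits-whole-blocks≤ q) (hits-block≤1 q d ≤-refl) ⟩
      q + 1                           ≡⟨ +-comm q 1 ⟩
      suc q                           ∎
      where open ≤-Reasoning

    hits-blocks≤ : ∀ q r → r ≤ d → hits 0 (q * d + r) ≤ suc q
    hits-blocks≤ q r r≤d = begin
      hits 0 (q * d + r)              ≡⟨ hits-+ 0 (q * d) r ⟩
      hits 0 (q * d) + hits (q * d) r ≤⟨ +-mono-≤ (hits-whole-blocks≤ q) (hits-block≤1 q r r≤d) ⟩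
      q + 1                           ≡⟨ +-comm q 1 ⟩
      suc q                           ∎
      where open ≤-Reasoning

    2*hits≤ : 3 ≤ d → ∀ n → 3 ≤ n → 2 * hits 0 n ≤ n
    2*hits≤ 3≤d (suc n) 3≤n = subst (λ m → 2 * hits 0 m ≤ m) (sym split) (≤-trans
      (*-monoʳ-≤ 2 (hits-blocks≤ (n / d) (suc (n % d)) (m%n<n n d)))
      (2*[1+q]≤q*d+[1+r] (n / d) (n % d) 3≤d (subst (3 ≤_) split 3≤n)))
      where
      split : suc n ≡ n / d * d + suc (n % d)
      split = trans (cong suc (trans (m≡m%n+[m/n]*n n d) (+-comm (n % d) _))) (sym (+-suc _ (n % d)))

filter-map-inj₂-none : ∀ {n} {P : V n → Set} (P? : Decidable P) → (∀ x → ¬ P (inj₂ x)) →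
                       (xs : List (Fin n)) → filter P? (map inj₂ xs) ≡ []
filter-map-inj₂-none P? ¬P []       = refl
filter-map-inj₂-none P? ¬P (x ∷ xs) =
  trans (filter-reject P? (¬P x)) (filter-map-inj₂-none P? ¬P xs)

module _ {n : ℕ} where

  deg-hub : ∀ i → deg (inj₁ {B = Fin n} i) ≡ n
  deg-hub i = trans (all-edges (allFin n)) (length-tabulate id)
    where
    all-edges : ∀ xs →
      length (filter (λ v → Bool.T? (isEdge (inj₁ i) v)) (map inj₂ xs)) ≡ length xs
    all-edges []       = refl
    all-edges (x ∷ xs) = cong suc (all-edges xs)

  deg-leaf : ∀ j → deg (inj₂ {A = Fin 2} {B = Fin n} j) ≡ 2
  deg-leaf j = cong (λ l → 2 + length l)
    (filter-map-inj₂-none (λ v → Bool.T? (isEdge (inj₂ j) v)) (λ _ ()) (allFin n))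

module _ {n k : ℕ} (c : EdgeColoring n k) where

  colDeg-hub : ∀ i α → colDeg c (inj₁ i) α ≡ length (filter (λ j → c i j ≟ᶠ α) (allFin n))
  colDeg-hub i α = go (allFin n)
    where
    go : ∀ xs → length (filter (λ v → Maybe.≡-dec _≟ᶠ_ (col c (inj₁ i) v) (just α)) (map inj₂ xs)) ≡
                length (filter (λ j → c i j ≟ᶠ α) xs)
    go []       = refl
    go (x ∷ xs) with does (c i x ≟ᶠ α)
    ... | true  = cong suc (go xs)
    ... | false = go xs

  no-leaf-edges : ∀ j α →
    filter (λ v → Maybe.≡-dec _≟ᶠ_ (col c (inj₂ j) v) (just α)) (map inj₂ (allFin n)) ≡ []
  no-leaf-edges j α = filter-map-inj₂-none _ (λ _ ()) (allFin n)

  majority-leaf : ∀ j → c zero j ≢ c (suc zero) j →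
                  ∀ α → 2 * colDeg c (inj₂ j) α ≤ deg (inj₂ {A = Fin 2} j)
  majority-leaf j c₀≢c₁ α rewrite deg-leaf j with c zero j ≟ᶠ α
  ... | yes c₀≡α with c (suc zero) j ≟ᶠ α
  ...   | yes c₁≡α = ⊥-elim (c₀≢c₁ (trans c₀≡α (sym c₁≡α)))
  ...   | no  _    rewrite no-leaf-edges j α = s≤s (s≤s z≤n)
  majority-leaf j c₀≢c₁ α | no _ with c (suc zero) j ≟ᶠ α
  ...   | yes _    rewrite no-leaf-edges j α = s≤s (s≤s z≤n)
  ...   | no  _    rewrite no-leaf-edges j α = z≤n

  isMajority : (∀ j → c zero j ≢ c (suc zero) j) →
               (∀ i α → 2 * length (filter (λ j → c i j ≟ᶠ α) (allFin n)) ≤ n) →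
               IsMajority c
  isMajority leaves hubs (inj₁ i) α rewrite colDeg-hub i α | deg-hub {n} i = hubs i α
  isMajority leaves hubs (inj₂ j) α = majority-leaf j (leaves j) α

neighbour-of-leaf : ∀ {n} {j : Fin n} w → Adj (inj₂ j) w → ∃ λ b → w ≡ inj₁ b
neighbour-of-leaf (inj₁ b) _ = b , refl

neighbour-of-hub : ∀ {n} {a : Fin 2} w → Adj {n} (inj₁ a) w → ∃ λ y → w ≡ inj₂ y
neighbour-of-hub (inj₂ y) _ = y , refl

module _ {n : ℕ} {φ : V n → V n} (automorphism : IsAutomorphism φ) (2<n : 2 < n) where

  private
    φ-injective : ∀ {u v} → φ u ≡ φ v → u ≡ v
    φ-injective = proj₁ (proj₁ automorphism)

    φ-adjacent : ∀ u v → Adj u v → Adj (φ u) (φ v)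
    φ-adjacent u v = proj₁ (proj₂ automorphism u v)

  leaves-not-all-to-hubs : ¬ (∀ x → ∃ λ b → φ (inj₂ x) ≡ inj₁ b)
  leaves-not-all-to-hubs image with x , y , x<y , same-hub ← pigeonhole 2<n (λ x → proj₁ (image x)) =
    <ᶠ-irrefl (inj₂-injective (φ-injective (begin
      φ (inj₂ x)             ≡⟨ proj₂ (image x) ⟩
      inj₁ (proj₁ (image x)) ≡⟨ cong inj₁ same-hub ⟩
      inj₁ (proj₁ (image y)) ≡⟨ proj₂ (image y) ⟨
      φ (inj₂ y)             ∎))) x<y
    where open ≡-Reasoning

  automorphism-hub : ∀ i → ∃ λ a → φ (inj₁ i) ≡ inj₁ a
  automorphism-hub i with φ (inj₁ i) in φi≡
  ... | inj₁ a = a , refl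
  ... | inj₂ j = ⊥-elim (leaves-not-all-to-hubs λ x →
    neighbour-of-leaf (φ (inj₂ x))
      (subst (λ w → Adj w (φ (inj₂ x))) φi≡ (φ-adjacent (inj₁ i) (inj₂ x) tt)))

  automorphism-leaf : ∀ x → ∃ λ y → φ (inj₂ x) ≡ inj₂ y
  automorphism-leaf x with a , φ0≡ ← automorphism-hub zero =
    neighbour-of-hub (φ (inj₂ x))
      (subst (λ w → Adj w (φ (inj₂ x))) φ0≡ (φ-adjacent (inj₁ zero) (inj₂ x) tt))

fin2-permutation : (σ : Fin 2 → Fin 2) → σ zero ≢ σ (suc zero) →
                   (σ zero ≡ zero × σ (suc zero) ≡ suc zero) ⊎
                   (σ zero ≡ suc zero × σ (suc zero) ≡ zero)
fin2-permutation σ σ₀≢σ₁ with σ zero | σ (suc zero)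
... | zero     | zero     = ⊥-elim (σ₀≢σ₁ refl)
... | zero     | suc zero = inj₁ (refl , refl)
... | suc zero | zero     = inj₂ (refl , refl)
... | suc zero | suc zero = ⊥-elim (σ₀≢σ₁ refl)

module _ {n k : ℕ} (c : EdgeColoring n k)
  (pairs-injective : ∀ x y → c zero x ≡ c zero y → c (suc zero) x ≡ c (suc zero) y → x ≡ y)
  (x₀ : Fin n)
  (x₀-unswappable : ∀ y → ¬ (c zero y ≡ c (suc zero) x₀ × c (suc zero) y ≡ c zero x₀)) where

  colour-preserving-permutations-trivial :
    (σ : Fin 2 → Fin 2) (ψ : Fin n → Fin n) → σ zero ≢ σ (suc zero) →
    (∀ i x → c (σ i) (ψ x) ≡ c i x) → (∀ i → σ i ≡ i) × (∀ x → ψ x ≡ x)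
  colour-preserving-permutations-trivial σ ψ σ₀≢σ₁ preserved =
    [ identity , ⊥-elim ∘ swap ] (fin2-permutation σ σ₀≢σ₁)
    where
    along : ∀ {i a} → σ i ≡ a → ∀ x → c a (ψ x) ≡ c i x
    along {i} σi≡a x = subst (λ b → c b (ψ x) ≡ c i x) σi≡a (preserved i x)
    identity : σ zero ≡ zero × σ (suc zero) ≡ suc zero →
               (∀ i → σ i ≡ i) × (∀ x → ψ x ≡ x)
    identity (σ₀ , σ₁) = (λ { zero → σ₀ ; (suc zero) → σ₁ }) ,
                         λ x → pairs-injective (ψ x) x (along σ₀ x) (along σ₁ x)
    swap : ¬ (σ zero ≡ suc zero × σ (suc zero) ≡ zero)
    swap (σ₀ , σ₁) = x₀-unswappable (ψ x₀) (along σ₁ x₀ , along σ₀ x₀)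

  isDistinguishing : 2 < n → IsDistinguishing c
  isDistinguishing 2<n φ automorphism preserves = fixed
    where
    hub = automorphism-hub automorphism 2<n
    leaf = automorphism-leaf automorphism 2<n
    σ : Fin 2 → Fin 2
    σ i = proj₁ (hub i)
    ψ : Fin n → Fin n
    ψ x = proj₁ (leaf x)
    σ-injective : σ zero ≢ σ (suc zero)
    σ-injective σ₀≡σ₁ with () ← proj₁ (proj₁ automorphism)
      (trans (proj₂ (hub zero)) (trans (cong inj₁ σ₀≡σ₁) (sym (proj₂ (hub (suc zero))))))
    colours : ∀ i x → c (σ i) (ψ x) ≡ c i x
    colours i x = Maybe.just-injective
      (trans (cong₂ (col c) (sym (proj₂ (hub i))) (sym (proj₂ (leaf x))))
             (preserves (inj₁ i) (inj₂ x) tt))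
    trivial = colour-preserving-permutations-trivial σ ψ σ-injective colours
    fixed : ∀ v → φ v ≡ v
    fixed (inj₁ i) = trans (proj₂ (hub i)) (cong inj₁ (proj₁ trivial i))
    fixed (inj₂ x) = trans (proj₂ (leaf x)) (cong inj₂ (proj₂ trivial x))

module PairColouring (k : ℕ) where

  d : ℕ
  d = 3 + k

  open Modular d

  -- d (d − 1) − 1
  capacity : ℕ
  capacity = suc (suc k) + suc k * d

  raw : Fin 2 → ℕ → ℕ
  raw zero       t = t
  raw (suc zero) t = t + suc (t / d)

  leafColour : Fin 2 → ℕ → Fin d
  leafColour i t = raw i t mod d

  colouring : (n : ℕ) → EdgeColoring n d
  colouring n i j = leafColour i (toℕ j)

  mod-injective : ∀ m n → m mod d ≡ n mod d → m % d ≡ n % d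
  mod-injective m n eq = trans (sym (toℕ-fromℕ< _)) (trans (cong toℕ eq) (toℕ-fromℕ< _))

  leafColour-injectiveOnBlocks : ∀ i → InjectiveOnBlocks d (leafColour i)
  leafColour-injectiveOnBlocks zero       t u q≡ eq = %-/-injective t u (mod-injective t u eq) q≡
  leafColour-injectiveOnBlocks (suc zero) t u q≡ eq =
    %-/-injective t u (+-cancelʳ-% (suc (u / d)) t u (begin
      (t + suc (u / d)) % d ≡⟨ cong (λ q → (t + suc q) % d) q≡ ⟨
      (t + suc (t / d)) % d ≡⟨ mod-injective (t + suc (t / d)) (u + suc (u / d)) eq ⟩
      (u + suc (u / d)) % d ∎)) q≡
    where open ≡-Reasoning

  <d⇒%-injective : ∀ {m n} → m < d → n < d → m % d ≡ n % d → m ≡ n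
  <d⇒%-injective m<d n<d eq = trans (sym (m<n⇒m%n≡m m<d)) (trans eq (m<n⇒m%n≡m n<d))

  leafColours-differ : ∀ {t} → suc (t / d) < d → leafColour zero t ≢ leafColour (suc zero) t
  leafColours-differ {t} 1+q<d eq with () ← <d⇒%-injective z<s 1+q<d
    (+-cancelˡ-% t 0 (suc (t / d))
      (trans (cong (_% d) (+-identityʳ t)) (mod-injective t (t + suc (t / d)) eq)))

  leafPairs-injective : ∀ {t u} → suc (t / d) < d → suc (u / d) < d →
                        leafColour zero t ≡ leafColour zero u →
                        leafColour (suc zero) t ≡ leafColour (suc zero) u → t ≡ u
  leafPairs-injective {t} {u} 1+q<d 1+q′<d eq₀ eq₁ =
    %-/-injective t u t%≡u% (suc-injective (<d⇒%-injective 1+q<d 1+q′<d 1+q%≡))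
    where
    open ≡-Reasoning
    t%≡u% : t % d ≡ u % d
    t%≡u% = mod-injective t u eq₀
    1+q%≡ : suc (t / d) % d ≡ suc (u / d) % d
    1+q%≡ = +-cancelˡ-% t (suc (t / d)) (suc (u / d)) (begin
      (t + suc (t / d)) % d ≡⟨ mod-injective (t + suc (t / d)) (u + suc (u / d)) eq₁ ⟩
      (u + suc (u / d)) % d ≡⟨ +-cong-% u t (suc (u / d)) (suc (u / d)) (sym t%≡u%) refl ⟩
      (t + suc (u / d)) % d ∎)

  swapped-pair-only-at-capacity : ∀ {t} → suc (t / d) < d →
    leafColour zero t ≡ leafColour (suc zero) (suc k) →
    leafColour (suc zero) t ≡ leafColour zero (suc k) → t ≡ capacity
  swapped-pair-only-at-capacity {t} 1+q<d e₀ e₁ = begin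
    t                                ≡⟨ m≡m%n+[m/n]*n t d ⟩
    t % d + t / d * d                ≡⟨ cong₂ (λ a q → a + q * d) t%d≡ (suc-injective 1+q≡) ⟩
    suc (suc k) % d + suc k * d      ≡⟨ cong (_+ suc k * d) (m<n⇒m%n≡m (n<1+n (suc (suc k)))) ⟩
    capacity                         ∎
    where
    open ≡-Reasoning
    raw₁[1+k] : raw (suc zero) (suc k) ≡ suc (suc k)
    raw₁[1+k] = trans (cong (λ q → suc k + suc q) (m<n⇒m/n≡0 (m<n⇒m<1+n (n<1+n (suc k)))))
                      (+-comm (suc k) 1)
    t%d≡ : t % d ≡ suc (suc k) % d
    t%d≡ = trans (mod-injective t (raw (suc zero) (suc k)) e₀) (cong (_% d) raw₁[1+k])
    1+q≡ : suc (t / d) ≡ suc (suc k)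
    1+q≡ = <d⇒%-injective 1+q<d (n<1+n (suc (suc k)))
      (+-cancelˡ-% (suc (suc k)) (suc (t / d)) (suc (suc k)) (begin
        (suc (suc k) + suc (t / d)) % d ≡⟨ +-cong-% (suc (suc k)) t _ _ (sym t%d≡) refl ⟩
        (t + suc (t / d)) % d           ≡⟨ mod-injective (t + suc (t / d)) (suc k) e₁ ⟩
        suc k % d                       ≡⟨ [m+n]%n≡m%n (suc k) d ⟨
        (suc k + d) % d                 ≡⟨ cong (_% d) (+-suc (suc k) (suc (suc k))) ⟩
        (suc (suc k) + suc (suc k)) % d ∎))

  leaf-1+q<d : ∀ {n} → n ≤ capacity → (j : Fin n) → suc (toℕ j / d) < d
  leaf-1+q<d n≤cap j = s≤s (m<n*o⇒m/o<n (begin-strict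
    toℕ j                     <⟨ toℕ<n j ⟩
    _                         ≤⟨ n≤cap ⟩
    suc (suc k) + suc k * d   ≤⟨ +-monoˡ-≤ (suc k * d) (n≤1+n (suc (suc k))) ⟩
    suc (suc k) * d           ∎))
    where open ≤-Reasoning

  colouring-isMajority : ∀ n → 3 ≤ n → n ≤ capacity → IsMajority (colouring n)
  colouring-isMajority n 3≤n n≤cap = isMajority (colouring n)
    (λ j → leafColours-differ {toℕ j} (leaf-1+q<d n≤cap j))
    λ i α → let open Hits _≟ᶠ_ (leafColour i) α in
      subst (λ h → 2 * h ≤ n) (sym (hits-tabulate n 0 id λ _ → refl))
            (2*hits≤ (leafColour-injectiveOnBlocks i) (s≤s (s≤s (s≤s z≤n))) n 3≤n)

  colouring-isDistinguishing : ∀ n → 3 ≤ n → suc k < n → n ≤ capacity →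
                               IsDistinguishing (colouring n)
  colouring-isDistinguishing n 3≤n 1+k<n n≤cap =
    isDistinguishing (colouring n) pairs-injective x₀ unswappable 3≤n
    where
    pairs-injective : ∀ x y → colouring n zero x ≡ colouring n zero y →
                      colouring n (suc zero) x ≡ colouring n (suc zero) y → x ≡ y
    pairs-injective x y e₀ e₁ =
      toℕ-injective (leafPairs-injective (leaf-1+q<d n≤cap x) (leaf-1+q<d n≤cap y) e₀ e₁)
    x₀ : Fin n
    x₀ = fromℕ< 1+k<n
    unswappable : ∀ y → ¬ (colouring n zero y ≡ colouring n (suc zero) x₀ ×
                           colouring n (suc zero) y ≡ colouring n zero x₀)
    unswappable y (e₀ , e₁) with toℕ x₀ | toℕ-fromℕ< 1+k<n
    ... | _ | refl = <-irrefl (swapped-pair-only-at-capacity (leaf-1+q<d n≤cap y) e₀ e₁)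
                              (<-≤-trans (toℕ<n y) n≤cap)

proposition15 : (n : ℕ) → 3 ≤ n →
    (m : ℕ) → n ≤ m * (m ∸ 1) ∸ 1 → ((k : ℕ) → n ≤ k * (k ∸ 1) ∸ 1 → m ≤ k) →
    Σ (EdgeColoring n m) (λ c → IsMajority c × IsDistinguishing c)
proposition15 n 3≤n 0                   n≤0 _ with () ← ≤-trans 3≤n n≤0
proposition15 n 3≤n 1                   n≤0 _ with () ← ≤-trans 3≤n n≤0
proposition15 n 3≤n 2                   n≤1 _ with s≤s () ← ≤-trans 3≤n n≤1
proposition15 n 3≤n (suc (suc (suc k))) n≤bound minimal =
  colouring n ,
  colouring-isMajority n 3≤n n≤capacity ,
  colouring-isDistinguishing n 3≤n 1+k<n n≤capacity
  where
  open PairColouring k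
  bound≡ : ∀ k → (3 + k) * (2 + k) ≡ suc (suc (suc k) + suc k * (3 + k))
  bound≡ = solve-∀
  n≤capacity : n ≤ capacity
  n≤capacity = subst (λ b → n ≤ b ∸ 1) (bound≡ k) n≤bound
  1+k<n : suc k < n
  1+k<n = ≤-<-trans (≤-trans (m≤m*n (suc k) (suc k)) (m≤n+m _ k))
                    (≰⇒> λ n≤smaller → <-irrefl refl (minimal (2 + k) n≤smaller))
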